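{- Let $G$ be a finite simple graph and let $x,y$ be two distinct vertices of $G$. If $G$ has a $(2k+1,k)$-configuration for some positive integer $k$, then for some positive integer $r\le 2k+1$, $G$ has an $(x,y)$-nice $(2r+1,r)$-configuration.
   Context: A set is dominating if every vertex outside it has a neighbour in it. A $(k,s)$-configuration of a graph is a multiset of $k$ (not necessarily distinct) dominating sets such that every vertex lies in at most $s$ of them. For a multiset $\mathcal D$ of dominating sets and distinct vertices $x,y$, let $\mathcal D_x=\{D\in\mathcal D: x\in D, y\notin D\}$, $\mathcal D_y=\{D\in\mathcal D: y\in D, x\notin D\}$, $\mathcal D_{xy}=\{D\in\mathcal D: x,y\in D\}$ (as multisets). A $(2r+1,r)$-configuration $\mathcal D$ is $(x,y)$-nice if each of $x$ and $y$ belongs to exactly $r$ sets of $\mathcal D$ and $\mathcal D_x,\mathcal D_y,\mathcal D_{xy}$ are all nonempty. -}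

module Defs where

open import Data.Nat using (ℕ; zero; suc; _+_; _≤_)
open import Data.Bool using (Bool; true; false)
open import Data.Fin using (Fin)
open import Data.Fin.Subset using (Subset; _∈_; _∉_)
open import Data.Vec using (Vec; lookup; []; _∷_)
open import Data.Product using (Σ; ∃; _×_)
open import Relation.Binary.PropositionalEquality using (_≡_)
open import Relation.Nullary using (¬_)

record Graph (n : ℕ) : Set where
  field
    adj    : Fin n → Fin n → Bool
    sym    : ∀ u v → adj u v ≡ adj v u
    irrefl : ∀ v → adj v v ≡ false
open Graph public

Dominating : ∀ {n} → Graph n → Subset n → Set
Dominating {n} G D = ∀ (v : Fin n) → v ∉ D → ∃ λ (u : Fin n) → adj G v u ≡ true × u ∈ D

-- A multiset of k sets is represented as a Vec of length k (order irrelevant).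
-- Number of sets in the family containing vertex v (counted with multiplicity).
occ : ∀ {n k} → Vec (Subset n) k → Fin n → ℕ
occ [] v = zero
occ (D ∷ Ds) v with lookup D v
... | true  = suc (occ Ds v)
... | false = occ Ds v

IsConfig : ∀ {n} → Graph n → (k s : ℕ) → Vec (Subset n) k → Set
IsConfig {n} G k s 𝒟 =
  (∀ (i : Fin k) → Dominating G (lookup 𝒟 i)) × (∀ (v : Fin n) → occ 𝒟 v ≤ s)

HasConfig : ∀ {n} → Graph n → (k s : ℕ) → Set
HasConfig G k s = Σ (Vec _ k) λ 𝒟 → IsConfig G k s 𝒟

IsNice : ∀ {n} → Graph n → Fin n → Fin n → (r : ℕ) → Vec (Subset n) (suc (r + r)) → Set
IsNice G x y r 𝒟 =
  IsConfig G (suc (r + r)) r 𝒟 ×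
  occ 𝒟 x ≡ r × occ 𝒟 y ≡ r ×
  (∃ λ i → x ∈ lookup 𝒟 i × y ∉ lookup 𝒟 i) ×
  (∃ λ i → y ∈ lookup 𝒟 i × x ∉ lookup 𝒟 i) ×
  (∃ λ i → x ∈ lookup 𝒟 i × y ∈ lookup 𝒟 i)

-- Since x and y together lie in at most 2k of the 2k+1 sets, some set N of the configuration
-- avoids both.  Removing N and adding x, resp. y, to further sets leaves 2k dominating sets R
-- in which x and y each occur exactly k times, while every other vertex v still satisfies
-- [v ∈ N] + occ R v ≤ k.  Then A, B, R, N, R is a (4k+3, 2k+1)-configuration for any two
-- dominating sets A, B that agree with N off {x, y} and share x and y between them, one each.
-- If some set of R contains both x and y take A = N ∪ {x}, B = N ∪ {y}; otherwise take A = N,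
-- B = N ∪ {x, y}, and the sets of R containing x (resp. y) contain only x (resp. y).
module Submission where

open import Defs hiding (sym)
open import Data.Nat using (ℕ; zero; suc; _+_; _∸_; _≤_; _<_; z≤n; s≤s)
open import Data.Nat.Properties
  using (≤-refl; ≤-reflexive; ≤-trans; ≤-pred; n≤1+n; m≤m+n; +-suc; +-assoc; +-mono-≤; +-monoʳ-≤; m∸n+n≡m)
open import Data.Bool using (Bool; true; false)
open import Function using (id)
open import Data.Fin using (Fin; zero; suc; _↑ˡ_; punchIn; _≟_)
open import Data.Fin.Properties using (any?)
open import Data.Fin.Subset using (Subset; _∈_; _∉_; _⊆_; inside)
open import Data.Fin.Subset.Properties using (_∈?_)
open import Data.Vec using (Vec; lookup; []; _∷_; _++_; _[_]≔_; insertAt; removeAt)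
open import Data.Vec.Properties
  using ([]=⇒lookup; lookup⇒[]=; lookup∘update; lookup∘update′; []≔-updates; []≔-minimal;
         lookup-++ˡ; insertAt-punchIn; insertAt-removeAt)
open import Data.Vec.Relation.Unary.All using (All; _∷_)
open import Data.Vec.Relation.Unary.All.Properties using (lookup⁺; lookup⁻; ++⁺)
open import Data.Product using (Σ; ∃; _×_; _,_; map)
open import Relation.Binary.PropositionalEquality using (_≡_; _≢_; refl; sym; trans; cong; cong₂; subst)
open import Relation.Binary.PropositionalEquality.Properties using (module ≡-Reasoning)
open import Relation.Nullary using (¬_; yes; no)
open import Relation.Nullary.Decidable using (_×-dec_)

toℕ : Bool → ℕ
toℕ false = 0
toℕ true  = 1

lookup≡false⇒∉ : ∀ {n} {S : Subset n} {v} → lookup S v ≡ false → v ∉ S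
lookup≡false⇒∉ eq v∈S with trans (sym ([]=⇒lookup v∈S)) eq
... | ()

⊆-[]≔inside : ∀ {n} (S : Subset n) v → S ⊆ S [ v ]≔ inside
⊆-[]≔inside S v {u} u∈S with u ≟ v
... | yes refl = []≔-updates S u
... | no u≢v   = []≔-minimal S u v u≢v u∈S

Dominating-⊆ : ∀ {n} (G : Graph n) {S T : Subset n} → S ⊆ T → Dominating G S → Dominating G T
Dominating-⊆ G S⊆T domS v v∉T =
  let (u , uv , u∈S) = domS v (λ v∈S → v∉T (S⊆T v∈S)) in u , uv , S⊆T u∈S

occ-∷ : ∀ {n k} (D : Subset n) (Ds : Vec (Subset n) k) v →
  occ (D ∷ Ds) v ≡ toℕ (lookup D v) + occ Ds v
occ-∷ D Ds v with lookup D v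
... | true  = refl
... | false = refl

occ-++ : ∀ {n a b} (As : Vec (Subset n) a) (Bs : Vec (Subset n) b) v →
  occ (As ++ Bs) v ≡ occ As v + occ Bs v
occ-++ []       Bs v = refl
occ-++ (A ∷ As) Bs v with lookup A v
... | true  = cong suc (occ-++ As Bs v)
... | false = occ-++ As Bs v

occ-insertAt : ∀ {n k} (Ds : Vec (Subset n) k) i D v →
  occ (insertAt Ds i D) v ≡ toℕ (lookup D v) + occ Ds v
occ-insertAt Ds       zero    D v = occ-∷ D Ds v
occ-insertAt (E ∷ Ds) (suc i) D v with lookup E v
... | true  = trans (cong suc (occ-insertAt Ds i D v))
                    (sym (+-suc (toℕ (lookup D v)) (occ Ds v)))
... | false = occ-insertAt Ds i D v

occ-removeAt : ∀ {n k} (Ds : Vec (Subset n) (suc k)) i v →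
  occ Ds v ≡ toℕ (lookup (lookup Ds i) v) + occ (removeAt Ds i) v
occ-removeAt Ds i v = trans (cong (λ Es → occ Es v) (sym (insertAt-removeAt Ds i)))
                            (occ-insertAt (removeAt Ds i) i (lookup Ds i) v)

lookup-removeAt : ∀ {n k} (Ds : Vec (Subset n) (suc k)) i j →
  lookup (removeAt Ds i) j ≡ lookup Ds (punchIn i j)
lookup-removeAt Ds i j = trans (sym (insertAt-punchIn (removeAt Ds i) i (lookup Ds i) j))
                               (cong (λ Es → lookup Es (punchIn i j)) (insertAt-removeAt Ds i))

occ>0⇒∃∈ : ∀ {n k} (Ds : Vec (Subset n) k) v → 0 < occ Ds v → ∃ λ i → v ∈ lookup Ds i
occ>0⇒∃∈ (D ∷ Ds) v pos with lookup D v in eq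
... | true  = zero , lookup⇒[]= v D eq
... | false = let (i , v∈) = occ>0⇒∃∈ Ds v pos in suc i , v∈

∃-avoiding : ∀ {n m} (Ds : Vec (Subset n) m) x y → occ Ds x + occ Ds y < m →
  ∃ λ i → lookup (lookup Ds i) x ≡ false × lookup (lookup Ds i) y ≡ false
∃-avoiding {m = suc m} (D ∷ Ds) x y lt with lookup D x in ex | lookup D y in ey
... | false | false = zero , ex , ey
... | true  | true  =
  map suc id (∃-avoiding Ds x y (≤-trans (s≤s (+-monoʳ-≤ (occ Ds x) (n≤1+n (occ Ds y)))) (≤-pred lt)))
... | true  | false = map suc id (∃-avoiding Ds x y (≤-pred lt))
... | false | true  =
  map suc id (∃-avoiding Ds x y (subst (_≤ m) (+-suc (occ Ds x) (occ Ds y)) (≤-pred lt)))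

addTo : ∀ {n m} → Fin n → ℕ → Vec (Subset n) m → Vec (Subset n) m
addTo v zero    Ds       = Ds
addTo v (suc e) []       = []
addTo v (suc e) (D ∷ Ds) with lookup D v
... | true  = D ∷ addTo v (suc e) Ds
... | false = D [ v ]≔ inside ∷ addTo v e Ds

addTo-⊇ : ∀ {n m} v e (Ds : Vec (Subset n) m) i → lookup Ds i ⊆ lookup (addTo v e Ds) i
addTo-⊇ v zero    Ds       i       = λ u∈ → u∈
addTo-⊇ v (suc e) (D ∷ Ds) i       with lookup D v
addTo-⊇ v (suc e) (D ∷ Ds) zero    | true  = λ u∈ → u∈
addTo-⊇ v (suc e) (D ∷ Ds) (suc i) | true  = addTo-⊇ v (suc e) Ds i
addTo-⊇ v (suc e) (D ∷ Ds) zero    | false = ⊆-[]≔inside D v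
addTo-⊇ v (suc e) (D ∷ Ds) (suc i) | false = addTo-⊇ v e Ds i

occ-addTo-≢ : ∀ {n m} v e (Ds : Vec (Subset n) m) u → u ≢ v → occ (addTo v e Ds) u ≡ occ Ds u
occ-addTo-≢ v zero    Ds       u u≢v = refl
occ-addTo-≢ v (suc e) []       u u≢v = refl
occ-addTo-≢ v (suc e) (D ∷ Ds) u u≢v with lookup D v
... | true  = trans (occ-∷ D _ u)
                    (trans (cong (toℕ (lookup D u) +_) (occ-addTo-≢ v (suc e) Ds u u≢v))
                           (sym (occ-∷ D Ds u)))
... | false = trans (occ-∷ (D [ v ]≔ inside) _ u)
                    (trans (cong₂ (λ b o → toℕ b + o) (lookup∘update′ u≢v D inside)
                                  (occ-addTo-≢ v e Ds u u≢v))
                           (sym (occ-∷ D Ds u)))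

occ-addTo : ∀ {n m} v e (Ds : Vec (Subset n) m) → e + occ Ds v ≤ m →
  occ (addTo v e Ds) v ≡ e + occ Ds v
occ-addTo v zero    Ds       room = refl
occ-addTo {m = suc m} v (suc e) (D ∷ Ds) room with lookup D v in eq
... | true  = trans (occ-∷ D _ v)
                    (trans (cong₂ (λ b o → toℕ b + o) eq
                                  (occ-addTo v (suc e) Ds
                                     (≤-pred (subst (_≤ suc m) (+-suc (suc e) (occ Ds v)) room))))
                           (sym (+-suc (suc e) (occ Ds v))))
... | false = trans (occ-∷ (D [ v ]≔ inside) _ v)
                    (cong₂ (λ b o → toℕ b + o) (lookup∘update v D inside)
                           (occ-addTo v e Ds (≤-pred room)))

occ-addTo-∸ : ∀ {n m} v k (Ds : Vec (Subset n) m) → occ Ds v ≤ k → k ≤ m →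
  occ (addTo v (k ∸ occ Ds v) Ds) v ≡ k
occ-addTo-∸ v k Ds occ≤k k≤m =
  trans (occ-addTo v (k ∸ occ Ds v) Ds (subst (_≤ _) (sym (m∸n+n≡m occ≤k)) k≤m)) (m∸n+n≡m occ≤k)

record Split {n} (G : Graph n) (x y : Fin n) (k : ℕ) : Set where
  field
    N            : Subset n
    R            : Vec (Subset n) (k + k)
    N-dominating : Dominating G N
    R-dominating : All (Dominating G) R
    x∉N          : lookup N x ≡ false
    y∉N          : lookup N y ≡ false
    occ-x        : occ R x ≡ k
    occ-y        : occ R y ≡ k
    occ-other    : ∀ v → v ≢ x → v ≢ y → toℕ (lookup N v) + occ R v ≤ k

split : ∀ {n} {G : Graph n} {x y : Fin n} {k} → x ≢ y →
  (Ds : Vec (Subset n) (suc (k + k))) → IsConfig G (suc (k + k)) k Ds → Split G x y k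
split {n} {G} {x} {y} {k} x≢y Ds (dom , bound)
  with ∃-avoiding Ds x y (s≤s (+-mono-≤ (bound x) (bound y)))
... | i , x∉N , y∉N = record
  { N            = N
  ; R            = R
  ; N-dominating = dom i
  ; R-dominating = lookup⁻ λ j →
      Dominating-⊆ G (λ u∈ → addTo-⊇ y e₁ R₁ j (addTo-⊇ x e₀ R₀ j u∈))
                     (subst (Dominating G) (sym (lookup-removeAt Ds i j)) (dom (punchIn i j)))
  ; x∉N          = x∉N
  ; y∉N          = y∉N
  ; occ-x        = trans (occ-addTo-≢ y e₁ R₁ x x≢y)
                         (occ-addTo-∸ x k R₀ (occ-R₀ x x∉N) k≤k+k)
  ; occ-y        = occ-addTo-∸ y k R₁ (subst (_≤ k) (sym occ-R₁-y) (occ-R₀ y y∉N)) k≤k+k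
  ; occ-other    = λ v v≢x v≢y → subst (λ o → toℕ (lookup N v) + o ≤ k)
                       (sym (trans (occ-addTo-≢ y e₁ R₁ v v≢y) (occ-addTo-≢ x e₀ R₀ v v≢x)))
                       (N+R₀-bound v)
  }
  where
  N : Subset n
  N = lookup Ds i
  e₀ e₁ : ℕ
  R₀ R₁ R : Vec (Subset n) (k + k)
  R₀ = removeAt Ds i
  e₀ = k ∸ occ R₀ x
  R₁ = addTo x e₀ R₀
  e₁ = k ∸ occ R₁ y
  R  = addTo y e₁ R₁
  k≤k+k : k ≤ k + k
  k≤k+k = m≤m+n k k
  N+R₀-bound : ∀ v → toℕ (lookup N v) + occ R₀ v ≤ k
  N+R₀-bound v = subst (_≤ k) (occ-removeAt Ds i v) (bound v)
  occ-R₀ : ∀ v → lookup N v ≡ false → occ R₀ v ≤ k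
  occ-R₀ v v∉N = subst (λ b → toℕ b + occ R₀ v ≤ k) v∉N (N+R₀-bound v)
  occ-R₁-y : occ R₁ y ≡ occ R₀ y
  occ-R₁-y = occ-addTo-≢ x e₀ R₀ y (λ y≡x → x≢y (sym y≡x))

doubling-bound : ∀ b o k → toℕ b + o ≤ k → toℕ b + toℕ b + (o + (toℕ b + o)) ≤ suc (k + k)
doubling-bound false o k le = ≤-trans (+-mono-≤ le le) (n≤1+n (k + k))
doubling-bound true  o k le = s≤s (+-mono-≤ le le)

module _ {n} {G : Graph n} {x y : Fin n} {k} (S : Split G x y k) where
  open Split S

  doubled : Subset n → Subset n → Vec (Subset n) (suc (suc (k + k) + suc (k + k)))
  doubled A B = A ∷ B ∷ R ++ N ∷ R

  occ-doubled : ∀ A B v →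
    occ (doubled A B) v
      ≡ toℕ (lookup A v) + toℕ (lookup B v) + (occ R v + (toℕ (lookup N v) + occ R v))
  occ-doubled A B v = begin
    occ (doubled A B) v
      ≡⟨ occ-∷ A _ v ⟩
    a + occ (B ∷ R ++ N ∷ R) v
      ≡⟨ cong (a +_) (occ-∷ B _ v) ⟩
    a + (b + occ (R ++ N ∷ R) v)
      ≡⟨ sym (+-assoc a b _) ⟩
    a + b + occ (R ++ N ∷ R) v
      ≡⟨ cong (a + b +_) (trans (occ-++ R (N ∷ R) v) (cong (occ R v +_) (occ-∷ N R v))) ⟩
    a + b + (occ R v + (toℕ (lookup N v) + occ R v)) ∎
    where
    open ≡-Reasoning
    a b : ℕ
    a = toℕ (lookup A v)
    b = toℕ (lookup B v)

  occ-doubled-xy : ∀ A B v → occ R v ≡ k → lookup N v ≡ false →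
    toℕ (lookup A v) + toℕ (lookup B v) ≡ 1 →
    occ (doubled A B) v ≡ suc (k + k)
  occ-doubled-xy A B v occ≡k v∉N once rewrite occ-doubled A B v | once | occ≡k | v∉N = refl

  ∃-doubled-R : ∀ {A B} (P : Subset n → Set) i → P (lookup R i) → ∃ λ j → P (lookup (doubled A B) j)
  ∃-doubled-R P i p =
    suc (suc (i ↑ˡ suc (k + k))) , subst P (sym (lookup-++ˡ R (N ∷ R) i)) p

  doubled-nice : ∀ {A B} → Dominating G A → Dominating G B →
    (∀ v → v ≢ x → v ≢ y → lookup A v ≡ lookup N v × lookup B v ≡ lookup N v) →
    toℕ (lookup A x) + toℕ (lookup B x) ≡ 1 → toℕ (lookup A y) + toℕ (lookup B y) ≡ 1 →
    (∃ λ i → x ∈ lookup (doubled A B) i × y ∉ lookup (doubled A B) i) →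
    (∃ λ i → y ∈ lookup (doubled A B) i × x ∉ lookup (doubled A B) i) →
    (∃ λ i → x ∈ lookup (doubled A B) i × y ∈ lookup (doubled A B) i) →
    IsNice G x y (suc (k + k)) (doubled A B)
  doubled-nice {A} {B} domA domB agree once-x once-y only-x only-y both =
    (lookup⁺ all-dominating , bound) , occ-x′ , occ-y′ , only-x , only-y , both
    where
    all-dominating : All (Dominating G) (doubled A B)
    all-dominating = domA ∷ domB ∷ ++⁺ R-dominating (N-dominating ∷ R-dominating)
    occ-x′ : occ (doubled A B) x ≡ suc (k + k)
    occ-x′ = occ-doubled-xy A B x occ-x x∉N once-x
    occ-y′ : occ (doubled A B) y ≡ suc (k + k)
    occ-y′ = occ-doubled-xy A B y occ-y y∉N once-y
    bound : ∀ v → occ (doubled A B) v ≤ suc (k + k)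
    bound v with v ≟ x | v ≟ y
    ... | yes refl | _        = ≤-reflexive occ-x′
    ... | no _     | yes refl = ≤-reflexive occ-y′
    ... | no v≢x   | no v≢y   =
      let (A≡N , B≡N) = agree v v≢x v≢y in
      subst (_≤ suc (k + k))
        (sym (trans (occ-doubled A B v) (cong₂ (λ a b → toℕ a + toℕ b + _) A≡N B≡N)))
        (doubling-bound (lookup N v) (occ R v) k (occ-other v v≢x v≢y))

  Nice : Set
  Nice = Σ (Vec (Subset n) (suc (suc (k + k) + suc (k + k)))) (IsNice G x y (suc (k + k)))

  nice-shared : x ≢ y → ∀ i → x ∈ lookup R i → y ∈ lookup R i → Nice
  nice-shared x≢y i x∈Rᵢ y∈Rᵢ =
    doubled N+x N+y ,
    doubled-nice (Dominating-⊆ G (⊆-[]≔inside N x) N-dominating)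
                 (Dominating-⊆ G (⊆-[]≔inside N y) N-dominating)
                 (λ v v≢x v≢y → lookup∘update′ v≢x N inside , lookup∘update′ v≢y N inside)
                 (cong₂ (λ a b → toℕ a + toℕ b) (lookup∘update x N inside) x∉N+y)
                 (cong₂ (λ a b → toℕ a + toℕ b) y∉N+x (lookup∘update y N inside))
                 (zero , []≔-updates N x , lookup≡false⇒∉ y∉N+x)
                 (suc zero , []≔-updates N y , lookup≡false⇒∉ x∉N+y)
                 (∃-doubled-R (λ S → x ∈ S × y ∈ S) i (x∈Rᵢ , y∈Rᵢ))
    where
    N+x N+y : Subset n
    N+x = N [ x ]≔ inside
    N+y = N [ y ]≔ inside
    x∉N+y : lookup N+y x ≡ false
    x∉N+y = trans (lookup∘update′ x≢y N inside) x∉N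
    y∉N+x : lookup N+x y ≡ false
    y∉N+x = trans (lookup∘update′ (λ y≡x → x≢y (sym y≡x)) N inside) y∉N

  nice-unshared : 0 < k → x ≢ y → ¬ (∃ λ i → x ∈ lookup R i × y ∈ lookup R i) → Nice
  nice-unshared 0<k x≢y ¬shared =
    doubled N N+x+y ,
    doubled-nice N-dominating
                 (Dominating-⊆ G (λ u∈ → ⊆-[]≔inside N+x y (⊆-[]≔inside N x u∈)) N-dominating)
                 (λ v v≢x v≢y →
                    refl , trans (lookup∘update′ v≢y N+x inside) (lookup∘update′ v≢x N inside))
                 (cong₂ (λ a b → toℕ a + toℕ b) x∉N
                        (trans (lookup∘update′ x≢y N+x inside) (lookup∘update x N inside)))
                 (cong₂ (λ a b → toℕ a + toℕ b) y∉N (lookup∘update y N+x inside))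
                 (only x y (occ>0⇒∃∈ R x (subst (0 <_) (sym occ-x) 0<k))
                       (λ x∈ y∈ → ¬shared (_ , x∈ , y∈)))
                 (only y x (occ>0⇒∃∈ R y (subst (0 <_) (sym occ-y) 0<k))
                       (λ y∈ x∈ → ¬shared (_ , x∈ , y∈)))
                 (suc zero , []≔-minimal N+x x y x≢y ([]≔-updates N x) , []≔-updates N+x y)
    where
    N+x N+x+y : Subset n
    N+x   = N [ x ]≔ inside
    N+x+y = N+x [ y ]≔ inside
    only : ∀ u w → (∃ λ i → u ∈ lookup R i) → (∀ {i} → u ∈ lookup R i → w ∉ lookup R i) →
      ∃ λ j → u ∈ lookup (doubled N N+x+y) j × w ∉ lookup (doubled N N+x+y) j
    only u w (i , u∈) excl = ∃-doubled-R (λ S → u ∈ S × w ∉ S) i (u∈ , excl u∈)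

  nice : 0 < k → x ≢ y → Nice
  nice 0<k x≢y with any? (λ i → x ∈? lookup R i ×-dec y ∈? lookup R i)
  ... | yes (i , x∈Rᵢ , y∈Rᵢ) = nice-shared x≢y i x∈Rᵢ y∈Rᵢ
  ... | no ¬shared            = nice-unshared 0<k x≢y ¬shared

lemma19 : ∀ {n} (G : Graph n) (x y : Fin n) → ¬ (x ≡ y) →
    (k : ℕ) → 0 < k → HasConfig G (suc (k + k)) k →
    ∃ λ (r : ℕ) → 0 < r × r ≤ suc (k + k) ×
      Σ (Vec _ (suc (r + r))) λ 𝒟 → IsNice G x y r 𝒟
lemma19 G x y x≢y k 0<k (Ds , config) =
  suc (k + k) , s≤s z≤n , ≤-refl , nice (split {G = G} {k = k} x≢y Ds config) 0<k x≢y
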